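{- Let $q\geq 2$ and $t\geq 2$. If $F$ is a graph on $q$ vertices with $e(F) < q^2/(2t^2)$, then $F$ has at least $\frac12\binom{q}{t}$ independent sets of size $t$. -}

module Defs where

open import Data.Bool using (Bool; true; false; _∧_; not)
open import Data.Nat using (ℕ; zero; suc; _+_; _≡ᵇ_; _<ᵇ_)
open import Data.Fin using (Fin; toℕ)
open import Data.Fin.Subset using (Subset; ∣_∣)
open import Data.Vec using ([]; _∷_; lookup)
open import Data.List using (List; []; _∷_; map; _++_; allFin; length; filterᵇ)
open import Data.Bool.ListAction using (and)
open import Data.Product using (_×_; _,_)
open import Data.List using (cartesianProduct)
open import Relation.Binary.PropositionalEquality using (_≡_)

record Graph (q : ℕ) : Set where
  field
    adj        : Fin q → Fin q → Bool
    adj-sym    : ∀ i j → adj i j ≡ adj j i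
    adj-irrefl : ∀ i → adj i i ≡ false
open Graph public

allSubsets : (n : ℕ) → List (Subset n)
allSubsets zero = [] ∷ []
allSubsets (suc n) = map (false ∷_) (allSubsets n) ++ map (true ∷_) (allSubsets n)

-- number of edges e(F): pairs (i , j) with i < j and i adjacent to j,
-- i.e. each unordered edge counted once
e : ∀ {q} → Graph q → ℕ
e {q} F = length (filterᵇ (λ { (i , j) → (toℕ i <ᵇ toℕ j) ∧ adj F i j })
                          (cartesianProduct (allFin q) (allFin q)))

isIndependentᵇ : ∀ {q} → Graph q → Subset q → Bool
isIndependentᵇ {q} F S =
  and (map (λ { (i , j) → not (lookup S i ∧ lookup S j ∧ adj F i j) })
           (cartesianProduct (allFin q) (allFin q)))

numIndependent : ∀ {q} → Graph q → ℕ → ℕ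
numIndependent {q} F t =
  length (filterᵇ (λ S → (∣ S ∣ ≡ᵇ t) ∧ isIndependentᵇ F S) (allSubsets q))

module Submission where

-- An edge lies in exactly C(q-2, t-2) of the t-sets, and every dependent
-- t-set contains an edge, so there are at most
-- e(F) C(q-2, t-2) = e(F) t(t-1)/(q(q-1)) C(q, t) dependent t-sets.  For t ≤ q
-- the density hypothesis makes this at most ½ C(q, t) (for t > q, C(q, t) = 0),
-- so the independent t-sets are at least as many as the dependent ones.

open import Defs
open import Data.Nat
  using (ℕ; zero; suc; _+_; _*_; _∸_; _≤_; _<_; _≡ᵇ_; _<ᵇ_; z≤n; s≤s; _≤?_)
open import Data.Nat.Properties
open import Algebra.Properties.CommutativeSemigroup +-commutativeSemigroup using (interchange)
open import Algebra.Properties.CommutativeSemigroup *-commutativeSemigroup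
  using (xy∙z≈y∙xz; x∙yz≈y∙xz; xy∙z≈xz∙y; xy∙z≈x∙zy)
open import Data.Nat.Combinatorics using (_C_; nC1≡n; nCk+nC[k+1]≡[n+1]C[k+1])
open import Data.Nat.Combinatorics.Specification using (k>n⇒nCk≡0)
open import Data.Nat.ListAction using (sum)
import Data.Nat.ListAction.Properties as Sum
open import Data.Nat.Solver using (module +-*-Solver)
open import Data.Bool using (Bool; true; false; _∧_; not; T)
open import Data.Bool.Properties using (T-∧; T-≡; T-not-≡; T?)
open import Data.Fin using (Fin; toℕ) renaming (zero to fz; suc to fs)
open import Data.Fin.Properties using (toℕ-injective)
open import Data.Fin.Subset using (Subset; ∣_∣; _∈_; _⊆_; ⁅_⁆; _∪_; ⊥; inside; outside)
open import Data.Fin.Subset.Properties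
  using (_⊆?_; p⊆q⇒∣p∣≤∣q∣; ∣p∣≤n; ∣⊥∣≡0; ⊆-min; ∣⁅x⁆∣≡1; ∪-identityˡ; ∪-identityʳ;
         x∈p∪q⁻; x∈⁅y⁆⇒x≡y)
open import Data.Vec using ([]; _∷_; lookup)
open import Data.Vec.Properties using (lookup⇒[]=)
open import Data.List using (List; []; _∷_; map; _++_; allFin; length; filterᵇ; cartesianProduct)
open import Data.List.Properties using (map-++; map-∘; map-cong)
import Data.List.Membership.Propositional as List
open import Data.List.Membership.Propositional.Properties using (∈-cartesianProduct⁺; ∈-allFin)
open import Data.List.Relation.Unary.Any using (here; there; satisfied)
open import Data.List.Relation.Unary.All.Properties using (all⁻; ¬All⇒Any¬)
open import Data.Product using (_×_; _,_; ∃₂; proj₁)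
open import Data.Sum using (_⊎_; inj₁; inj₂; [_,_]′)
open import Data.Unit using (tt)
open import Data.Empty using (⊥-elim)
open import Function using (_∘_; Equivalence)
open import Relation.Binary.Definitions using (tri<; tri≈; tri>)
open import Relation.Binary.PropositionalEquality
open import Relation.Nullary using (¬_; yes; no; contradiction)
open import Relation.Nullary.Decidable using (does; dec-true)

open Equivalence using (to; from)

private
  variable
    A B : Set
    n : ℕ

𝟙 : Bool → ℕ
𝟙 false = 0
𝟙 true  = 1

𝟙-T : ∀ {b} → T b → 𝟙 b ≡ 1
𝟙-T {true} _ = refl

𝟙-¬T : ∀ {b} → ¬ T b → 𝟙 b ≡ 0
𝟙-¬T {false} _ = refl
𝟙-¬T {true} ¬t = contradiction tt ¬t

𝟙-≤ : ∀ {b m} → (T b → 1 ≤ m) → 𝟙 b ≤ m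
𝟙-≤ {false} _ = z≤n
𝟙-≤ {true}  h = h tt

𝟙-split : ∀ a b → 𝟙 a ≡ 𝟙 (a ∧ b) + 𝟙 (a ∧ not b)
𝟙-split false _     = refl
𝟙-split true  false = refl
𝟙-split true  true  = refl

¬T-not⇒T : ∀ {b} → ¬ T (not b) → T b
¬T-not⇒T {true}  _  = tt
¬T-not⇒T {false} ¬t = contradiction tt ¬t

∑ : List A → (A → ℕ) → ℕ
∑ xs f = sum (map f xs)

infixr 6.5 ∑
syntax ∑ xs (λ x → f) = ∑[ x ∈ xs ] f

∑-++ : ∀ (f : A → ℕ) xs ys → ∑ (xs ++ ys) f ≡ ∑ xs f + ∑ ys f
∑-++ f xs ys = trans (cong sum (map-++ f xs ys)) (Sum.sum-++ (map f xs) (map f ys))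

∑-map : ∀ (f : B → ℕ) (g : A → B) xs → ∑ (map g xs) f ≡ ∑ xs (f ∘ g)
∑-map f g xs = cong sum (sym (map-∘ xs))

∑-cong : ∀ {f g : A → ℕ} → (∀ x → f x ≡ g x) → ∀ xs → ∑ xs f ≡ ∑ xs g
∑-cong f≗g xs = cong sum (map-cong f≗g xs)

∑-mono-≤ : ∀ {f g : A → ℕ} → (∀ x → f x ≤ g x) → ∀ xs → ∑ xs f ≤ ∑ xs g
∑-mono-≤ f≤g []       = z≤n
∑-mono-≤ f≤g (x ∷ xs) = +-mono-≤ (f≤g x) (∑-mono-≤ f≤g xs)

∑-zero : ∀ {f : A → ℕ} → (∀ x → f x ≡ 0) → ∀ xs → ∑ xs f ≡ 0
∑-zero f≗0 []       = refl
∑-zero f≗0 (x ∷ xs) = cong₂ _+_ (f≗0 x) (∑-zero f≗0 xs)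

∑-+ : ∀ (f g : A → ℕ) xs → ∑[ x ∈ xs ] (f x + g x) ≡ ∑ xs f + ∑ xs g
∑-+ f g []       = refl
∑-+ f g (x ∷ xs) =
  trans (cong ((f x + g x) +_) (∑-+ f g xs)) (interchange (f x) (g x) (∑ xs f) (∑ xs g))

∑-*ˡ : ∀ c (f : A → ℕ) xs → ∑[ x ∈ xs ] (c * f x) ≡ c * ∑ xs f
∑-*ˡ c f []       = sym (*-zeroʳ c)
∑-*ˡ c f (x ∷ xs) = trans (cong (c * f x +_) (∑-*ˡ c f xs)) (sym (*-distribˡ-+ c (f x) (∑ xs f)))

∑-*ʳ : ∀ c (f : A → ℕ) xs → ∑[ x ∈ xs ] (f x * c) ≡ ∑ xs f * c
∑-*ʳ c f []       = refl
∑-*ʳ c f (x ∷ xs) = trans (cong (f x * c +_) (∑-*ʳ c f xs)) (sym (*-distribʳ-+ c (f x) (∑ xs f)))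

∑-swap : ∀ (g : A → B → ℕ) xs ys →
  ∑[ y ∈ ys ] ∑[ x ∈ xs ] g x y ≡ ∑[ x ∈ xs ] ∑[ y ∈ ys ] g x y
∑-swap g xs []       = sym (∑-zero (λ _ → refl) xs)
∑-swap g xs (y ∷ ys) = trans (cong (∑[ x ∈ xs ] g x y +_) (∑-swap g xs ys))
                             (sym (∑-+ (λ x → g x y) (λ x → ∑[ y ∈ ys ] g x y) xs))

∈⇒≤∑ : ∀ (f : A → ℕ) {x xs} → x List.∈ xs → f x ≤ ∑ xs f
∈⇒≤∑ f (here refl)                  = m≤m+n _ _
∈⇒≤∑ f {xs = y ∷ _} (there x∈xs) = ≤-trans (∈⇒≤∑ f x∈xs) (m≤n+m _ (f y))

length-filterᵇ : ∀ (p : A → Bool) xs → length (filterᵇ p xs) ≡ ∑[ x ∈ xs ] 𝟙 (p x)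
length-filterᵇ p [] = refl
length-filterᵇ p (x ∷ xs) with p x
... | true  = cong suc (length-filterᵇ p xs)
... | false = length-filterᵇ p xs

∑-allSubsets-suc : ∀ n (f : Subset (suc n) → ℕ) →
  ∑ (allSubsets (suc n)) f ≡
  ∑[ S ∈ allSubsets n ] f (outside ∷ S) + ∑[ S ∈ allSubsets n ] f (inside ∷ S)
∑-allSubsets-suc n f = trans (∑-++ f (map (outside ∷_) (allSubsets n)) _)
  (cong₂ _+_ (∑-map f (outside ∷_) (allSubsets n)) (∑-map f (inside ∷_) (allSubsets n)))

#supersets : ∀ {m} (T : Subset n) → ∣ T ∣ ≡ m → ∀ k →
  ∑[ S ∈ allSubsets n ] 𝟙 (does (T ⊆? S) ∧ (∣ S ∣ ≡ᵇ m + k)) ≡ (n ∸ m) C k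
#supersets []             refl zero    = refl
#supersets []             refl (suc k) = refl
#supersets {suc n} (inside ∷ T) refl k =
  trans (∑-allSubsets-suc n _)
        (cong₂ _+_ (∑-zero (λ _ → refl) (allSubsets n)) (#supersets T refl k))
#supersets {suc n} (outside ∷ T) refl zero =
  -- the final refl is (n ∸ ∣ T ∣) C 0 + 0 ≡ (suc n ∸ ∣ T ∣) C 0: x C 0 computes to 1
  trans (∑-allSubsets-suc n _)
        (trans (cong₂ _+_ (#supersets T refl zero) (∑-zero too-small (allSubsets n))) refl)
  where
  too-small : ∀ S → 𝟙 (does (T ⊆? S) ∧ (suc ∣ S ∣ ≡ᵇ ∣ T ∣ + 0)) ≡ 0
  too-small S with T ⊆? S
  ... | no _    = refl
  ... | yes T⊆S = 𝟙-¬T λ 1+∣S∣≡∣T∣ →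
    ≤⇒≯ (p⊆q⇒∣p∣≤∣q∣ T⊆S)
        (≤-reflexive (trans (≡ᵇ⇒≡ _ _ 1+∣S∣≡∣T∣) (+-identityʳ ∣ T ∣)))
#supersets {suc n} (outside ∷ T) refl (suc k) = begin
  ∑[ S ∈ allSubsets (suc n) ] 𝟙 (does (outside ∷ T ⊆? S) ∧ (∣ S ∣ ≡ᵇ ∣ T ∣ + suc k))
    ≡⟨ ∑-allSubsets-suc n _ ⟩
  ∑[ S ∈ allSubsets n ] 𝟙 (does (T ⊆? S) ∧ (∣ S ∣ ≡ᵇ ∣ T ∣ + suc k)) +
  ∑[ S ∈ allSubsets n ] 𝟙 (does (T ⊆? S) ∧ (suc ∣ S ∣ ≡ᵇ ∣ T ∣ + suc k))
    ≡⟨ cong₂ _+_ (#supersets T refl (suc k))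
                 (trans (∑-cong shift (allSubsets n)) (#supersets T refl k)) ⟩
  (n ∸ ∣ T ∣) C suc k + (n ∸ ∣ T ∣) C k
    ≡⟨ +-comm ((n ∸ ∣ T ∣) C suc k) ((n ∸ ∣ T ∣) C k) ⟩
  (n ∸ ∣ T ∣) C k + (n ∸ ∣ T ∣) C suc k
    ≡⟨ nCk+nC[k+1]≡[n+1]C[k+1] (n ∸ ∣ T ∣) k ⟩
  suc (n ∸ ∣ T ∣) C suc k
    ≡⟨ cong (_C suc k) (+-∸-assoc 1 (∣p∣≤n T)) ⟨
  (suc n ∸ ∣ T ∣) C suc k ∎
  where
  open ≡-Reasoning
  shift : ∀ S → 𝟙 (does (T ⊆? S) ∧ (suc ∣ S ∣ ≡ᵇ ∣ T ∣ + suc k)) ≡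
                𝟙 (does (T ⊆? S) ∧ (∣ S ∣ ≡ᵇ ∣ T ∣ + k))
  shift S = cong (λ m → 𝟙 (does (T ⊆? S) ∧ (suc ∣ S ∣ ≡ᵇ m))) (+-suc ∣ T ∣ k)

#subsets : ∀ n k → ∑[ S ∈ allSubsets n ] 𝟙 (∣ S ∣ ≡ᵇ k) ≡ n C k
#subsets n k = trans (∑-cong ⊥⊆S (allSubsets n)) (#supersets ⊥ (∣⊥∣≡0 n) k)
  where
  ⊥⊆S : ∀ S → 𝟙 (∣ S ∣ ≡ᵇ k) ≡ 𝟙 (does (⊥ ⊆? S) ∧ (∣ S ∣ ≡ᵇ k))
  ⊥⊆S S rewrite dec-true (⊥ ⊆? S) (⊆-min S) = refl

∣⁅x⁆∪⁅y⁆∣≡2 : ∀ {x y : Fin n} → x ≢ y → ∣ ⁅ x ⁆ ∪ ⁅ y ⁆ ∣ ≡ 2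
∣⁅x⁆∪⁅y⁆∣≡2 {x = fz}   {fz}   x≢y = contradiction refl x≢y
∣⁅x⁆∪⁅y⁆∣≡2 {x = fz}   {fs y} _ = cong suc (trans (cong ∣_∣ (∪-identityˡ ⁅ y ⁆)) (∣⁅x⁆∣≡1 y))
∣⁅x⁆∪⁅y⁆∣≡2 {x = fs x} {fz}   _ = cong suc (trans (cong ∣_∣ (∪-identityʳ ⁅ x ⁆)) (∣⁅x⁆∣≡1 x))
∣⁅x⁆∪⁅y⁆∣≡2 {x = fs x} {fs y} x≢y = ∣⁅x⁆∪⁅y⁆∣≡2 (x≢y ∘ cong fs)

⁅x⁆∪⁅y⁆⊆p : ∀ {x y : Fin n} {p} → x ∈ p → y ∈ p → ⁅ x ⁆ ∪ ⁅ y ⁆ ⊆ p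
⁅x⁆∪⁅y⁆⊆p {x = x} {y} x∈p y∈p z∈ with x∈p∪q⁻ ⁅ x ⁆ ⁅ y ⁆ z∈
... | inj₁ z∈⁅x⁆ rewrite x∈⁅y⁆⇒x≡y x z∈⁅x⁆ = x∈p
... | inj₂ z∈⁅y⁆ rewrite x∈⁅y⁆⇒x≡y y z∈⁅y⁆ = y∈p

[1+k]*[1+n]C[1+k]≡[1+n]*nCk : ∀ n k → suc k * (suc n C suc k) ≡ suc n * (n C k)
[1+k]*[1+n]C[1+k]≡[1+n]*nCk zero    zero    = refl
[1+k]*[1+n]C[1+k]≡[1+n]*nCk zero    (suc k) = *-zeroʳ (2 + k)
[1+k]*[1+n]C[1+k]≡[1+n]*nCk (suc n) zero    =
  trans (*-identityˡ _) (trans (nC1≡n (2 + n)) (sym (*-identityʳ (2 + n))))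
[1+k]*[1+n]C[1+k]≡[1+n]*nCk (suc n) (suc k) = begin
  (2 + k) * ((2 + n) C (2 + k))
    ≡⟨ cong ((2 + k) *_) (nCk+nC[k+1]≡[n+1]C[k+1] (1 + n) (1 + k)) ⟨
  (2 + k) * (X + Y)
    ≡⟨ solve 3 (λ k x y → (con 2 :+ k) :* (x :+ y) := x :+ ((con 1 :+ k) :* x :+ (con 2 :+ k) :* y))
               refl k X Y ⟩
  X + ((1 + k) * X + (2 + k) * Y)
    ≡⟨ cong (X +_) (cong₂ _+_ (ih k) (ih (suc k))) ⟩
  X + ((1 + n) * (n C k) + (1 + n) * (n C suc k))
    ≡⟨ cong (X +_) (*-distribˡ-+ (1 + n) (n C k) (n C suc k)) ⟨
  X + (1 + n) * (n C k + n C suc k)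
    ≡⟨ cong (λ z → X + (1 + n) * z) (nCk+nC[k+1]≡[n+1]C[k+1] n k) ⟩
  (2 + n) * X ∎
  where
  open ≡-Reasoning
  open +-*-Solver
  ih : ∀ k → suc k * (suc n C suc k) ≡ suc n * (n C k)
  ih = [1+k]*[1+n]C[1+k]≡[1+n]*nCk n
  X Y : ℕ
  X = (1 + n) C (1 + k)
  Y = (1 + n) C (2 + k)

[2+k][1+k]*[2+n]C[2+k]≡[2+n][1+n]*nCk : ∀ n k →
  (2 + k) * (1 + k) * ((2 + n) C (2 + k)) ≡ (2 + n) * (1 + n) * (n C k)
[2+k][1+k]*[2+n]C[2+k]≡[2+n][1+n]*nCk n k = begin
  (2 + k) * (1 + k) * ((2 + n) C (2 + k))
    ≡⟨ xy∙z≈y∙xz (2 + k) (1 + k) ((2 + n) C (2 + k)) ⟩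
  (1 + k) * ((2 + k) * ((2 + n) C (2 + k)))
    ≡⟨ cong ((1 + k) *_) ([1+k]*[1+n]C[1+k]≡[1+n]*nCk (1 + n) (1 + k)) ⟩
  (1 + k) * ((2 + n) * ((1 + n) C (1 + k)))
    ≡⟨ x∙yz≈y∙xz (1 + k) (2 + n) ((1 + n) C (1 + k)) ⟩
  (2 + n) * ((1 + k) * ((1 + n) C (1 + k)))
    ≡⟨ cong ((2 + n) *_) ([1+k]*[1+n]C[1+k]≡[1+n]*nCk n k) ⟩
  (2 + n) * ((1 + n) * (n C k))
    ≡⟨ *-assoc (2 + n) (1 + n) (n C k) ⟨
  (2 + n) * (1 + n) * (n C k) ∎
  where open ≡-Reasoning

sparse⇒2e[1+t]t≤[1+q]q : ∀ {e t q} → t ≤ q →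
  2 * (suc t * suc t) * e ≤ suc q * suc q → 2 * e * (suc t * t) ≤ suc q * q
sparse⇒2e[1+t]t≤[1+q]q {e} {t} {q} t≤q sparse = *-cancelˡ-≤ (suc t) (begin
  suc t * (2 * e * (suc t * t)) ≡⟨ solve 2 (λ e t → (con 1 :+ t) :* (con 2 :* e :* ((con 1 :+ t) :* t))
                                                 := t :* (con 2 :* ((con 1 :+ t) :* (con 1 :+ t)) :* e))
                                           refl e t ⟩
  t * (2 * (suc t * suc t) * e) ≤⟨ *-monoʳ-≤ t sparse ⟩
  t * (suc q * suc q)           ≡⟨ *-assoc t (suc q) (suc q) ⟨
  t * suc q * suc q             ≤⟨ *-monoˡ-≤ (suc q) t[1+q]≤[1+t]q ⟩
  suc t * q * suc q             ≡⟨ xy∙z≈x∙zy (suc t) q (suc q) ⟩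
  suc t * (suc q * q)           ∎)
  where
  open ≤-Reasoning
  open +-*-Solver
  t[1+q]≤[1+t]q : t * suc q ≤ suc t * q
  t[1+q]≤[1+t]q = begin
    t * suc q ≡⟨ *-suc t q ⟩
    t + t * q ≤⟨ +-monoˡ-≤ (t * q) t≤q ⟩
    q + t * q ∎

2e·nCs≤[2+n]C[2+s] : ∀ n s e →
  2 * ((2 + s) * (2 + s)) * e < (2 + n) * (2 + n) → 2 * e * (n C s) ≤ (2 + n) C (2 + s)
2e·nCs≤[2+n]C[2+s] n s e sparse with s ≤? n
... | no  s≰n rewrite k>n⇒nCk≡0 (≰⇒> s≰n) | *-zeroʳ (2 * e) = z≤n
... | yes s≤n = *-cancelʳ-≤ _ _ ((2 + s) * (1 + s)) (begin
  2 * e * (n C s) * ((2 + s) * (1 + s))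
    ≡⟨ xy∙z≈xz∙y (2 * e) (n C s) _ ⟩
  2 * e * ((2 + s) * (1 + s)) * (n C s)
    ≤⟨ *-monoˡ-≤ (n C s) (sparse⇒2e[1+t]t≤[1+q]q {e} {1 + s} {1 + n} (s≤s s≤n) (<⇒≤ sparse)) ⟩
  (2 + n) * (1 + n) * (n C s)
    ≡⟨ [2+k][1+k]*[2+n]C[2+k]≡[2+n][1+n]*nCk n s ⟨
  (2 + s) * (1 + s) * ((2 + n) C (2 + s))
    ≡⟨ *-comm ((2 + s) * (1 + s)) _ ⟩
  ((2 + n) C (2 + s)) * ((2 + s) * (1 + s)) ∎)
  where open ≤-Reasoning

2n≤m+n⇒m+n≤2m : ∀ {m n} → 2 * n ≤ m + n → m + n ≤ 2 * m
2n≤m+n⇒m+n≤2m {m} {n} 2n≤m+n = begin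
  m + n       ≤⟨ +-monoʳ-≤ m n≤m ⟩
  m + m       ≡⟨ cong (m +_) (+-identityʳ m) ⟨
  2 * m       ∎
  where
  open ≤-Reasoning
  n≤m : n ≤ m
  n≤m = +-cancelʳ-≤ n n m (subst (_≤ m + n) (cong (n +_) (+-identityʳ n)) 2n≤m+n)

module _ {q} (F : Graph q) where

  pairs : List (Fin q × Fin q)
  pairs = cartesianProduct (allFin q) (allFin q)

  isEdge : Fin q × Fin q → Bool
  isEdge (i , j) = (toℕ i <ᵇ toℕ j) ∧ adj F i j

  edgeSet : Fin q × Fin q → Subset q
  edgeSet (i , j) = ⁅ i ⁆ ∪ ⁅ j ⁆

  numDependent : ℕ → ℕ
  numDependent t =
    length (filterᵇ (λ S → (∣ S ∣ ≡ᵇ t) ∧ not (isIndependentᵇ F S)) (allSubsets q))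

  e≡∑isEdge : e F ≡ ∑[ p ∈ pairs ] 𝟙 (isEdge p)
  e≡∑isEdge = trans (length-filterᵇ _ pairs) (∑-cong (λ { (i , j) → refl }) pairs)

  numIndependent+numDependent : ∀ t → numIndependent F t + numDependent t ≡ q C t
  numIndependent+numDependent t = begin
    numIndependent F t + numDependent t
      ≡⟨ cong₂ _+_ (length-filterᵇ _ (allSubsets q)) (length-filterᵇ _ (allSubsets q)) ⟩
    ∑[ S ∈ allSubsets q ] 𝟙 (size S ∧ indep S) + ∑[ S ∈ allSubsets q ] 𝟙 (size S ∧ not (indep S))
      ≡⟨ ∑-+ (λ S → 𝟙 (size S ∧ indep S)) (λ S → 𝟙 (size S ∧ not (indep S))) (allSubsets q) ⟨
    ∑[ S ∈ allSubsets q ] (𝟙 (size S ∧ indep S) + 𝟙 (size S ∧ not (indep S)))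
      ≡⟨ ∑-cong (λ S → 𝟙-split (size S) (indep S)) (allSubsets q) ⟨
    ∑[ S ∈ allSubsets q ] 𝟙 (size S)
      ≡⟨ #subsets q t ⟩
    q C t ∎
    where
    open ≡-Reasoning
    size : Subset q → Bool
    size S = ∣ S ∣ ≡ᵇ t
    indep : Subset q → Bool
    indep = isIndependentᵇ F

  isEdge⇒≢ : ∀ {i j} → T (isEdge (i , j)) → i ≢ j
  isEdge⇒≢ {i} ij refl = <-irrefl refl (<ᵇ⇒< (toℕ i) (toℕ i) (proj₁ (T-∧ .to ij)))

  adj⇒isEdge : ∀ {i j} → T (adj F i j) → T (isEdge (i , j)) ⊎ T (isEdge (j , i))
  adj⇒isEdge {i} {j} i~j with <-cmp (toℕ i) (toℕ j)
  ... | tri< i<j _ _ = inj₁ (T-∧ .from (<⇒<ᵇ i<j , i~j))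
  ... | tri> _ _ j<i = inj₂ (T-∧ .from (<⇒<ᵇ j<i , subst T (adj-sym F i j) i~j))
  ... | tri≈ _ i≡j _ with toℕ-injective i≡j
  ...   | refl = ⊥-elim (subst T (adj-irrefl F i) i~j)

  dependent⇒adjacent : ∀ {S} → T (not (isIndependentᵇ F S)) →
    ∃₂ λ i j → i ∈ S × j ∈ S × T (adj F i j)
  dependent⇒adjacent {S} dep
    with satisfied (¬All⇒Any¬ (T? ∘ _) pairs (subst T (T-not-≡ .to dep) ∘ all⁻ _))
  ... | (i , j) , ¬ok =
    let i∈S , j∈S∧i~j = T-∧ .to (¬T-not⇒T ¬ok)
        j∈S , i~j     = T-∧ .to j∈S∧i~j
    in i , j , lookup⇒[]= i S (T-≡ .to i∈S) , lookup⇒[]= j S (T-≡ .to j∈S) , i~j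

  containsᵇ : ℕ → Subset q → Fin q × Fin q → Bool
  containsᵇ t S p = does (edgeSet p ⊆? S) ∧ (∣ S ∣ ≡ᵇ t)

  edge⊆S⇒1≤∑containsᵇ : ∀ {t S i j} → T (∣ S ∣ ≡ᵇ t) → T (isEdge (i , j)) → i ∈ S → j ∈ S →
    1 ≤ ∑[ p ∈ pairs ] 𝟙 (isEdge p) * 𝟙 (containsᵇ t S p)
  edge⊆S⇒1≤∑containsᵇ {t} {S} {i} {j} size ij i∈S j∈S =
    ≤-trans (≤-reflexive (sym term≡1)) (∈⇒≤∑ _ (∈-cartesianProduct⁺ (∈-allFin i) (∈-allFin j)))
    where
    term≡1 : 𝟙 (isEdge (i , j)) * 𝟙 (containsᵇ t S (i , j)) ≡ 1
    term≡1 rewrite dec-true (edgeSet (i , j) ⊆? S) (⁅x⁆∪⁅y⁆⊆p i∈S j∈S) =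
      cong₂ _*_ (𝟙-T ij) (𝟙-T size)

  dependent≤∑containsᵇ : ∀ t S →
    𝟙 ((∣ S ∣ ≡ᵇ t) ∧ not (isIndependentᵇ F S)) ≤ ∑[ p ∈ pairs ] 𝟙 (isEdge p) * 𝟙 (containsᵇ t S p)
  dependent≤∑containsᵇ t S = 𝟙-≤ λ size∧dep →
    let size , dep = T-∧ .to size∧dep
        i , j , i∈S , j∈S , i~j = dependent⇒adjacent dep
    in [ (λ ij → edge⊆S⇒1≤∑containsᵇ size ij i∈S j∈S)
       , (λ ji → edge⊆S⇒1≤∑containsᵇ size ji j∈S i∈S)
       ]′ (adj⇒isEdge i~j)

  #containing-edge : ∀ s p →
    𝟙 (isEdge p) * (∑[ S ∈ allSubsets q ] 𝟙 (containsᵇ (2 + s) S p)) ≡ 𝟙 (isEdge p) * ((q ∸ 2) C s)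
  #containing-edge s p with T? (isEdge p)
  ... | yes edge = cong (𝟙 (isEdge p) *_) (#supersets (edgeSet p) (∣⁅x⁆∪⁅y⁆∣≡2 (isEdge⇒≢ edge)) s)
  ... | no ¬edge rewrite 𝟙-¬T ¬edge = refl

  numDependent≤e·C : ∀ s → numDependent (2 + s) ≤ e F * ((q ∸ 2) C s)
  numDependent≤e·C s = begin
    numDependent t
      ≡⟨ length-filterᵇ _ (allSubsets q) ⟩
    ∑[ S ∈ allSubsets q ] 𝟙 ((∣ S ∣ ≡ᵇ t) ∧ not (isIndependentᵇ F S))
      ≤⟨ ∑-mono-≤ (dependent≤∑containsᵇ t) (allSubsets q) ⟩
    ∑[ S ∈ allSubsets q ] ∑[ p ∈ pairs ] 𝟙 (isEdge p) * 𝟙 (containsᵇ t S p)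
      ≡⟨ ∑-swap (λ p S → 𝟙 (isEdge p) * 𝟙 (containsᵇ t S p)) pairs (allSubsets q) ⟩
    ∑[ p ∈ pairs ] ∑[ S ∈ allSubsets q ] 𝟙 (isEdge p) * 𝟙 (containsᵇ t S p)
      ≡⟨ ∑-cong (λ p → ∑-*ˡ (𝟙 (isEdge p)) (λ S → 𝟙 (containsᵇ t S p)) (allSubsets q)) pairs ⟩
    ∑[ p ∈ pairs ] 𝟙 (isEdge p) * (∑[ S ∈ allSubsets q ] 𝟙 (containsᵇ t S p))
      ≡⟨ ∑-cong (#containing-edge s) pairs ⟩
    ∑[ p ∈ pairs ] 𝟙 (isEdge p) * ((q ∸ 2) C s)
      ≡⟨ ∑-*ʳ ((q ∸ 2) C s) (𝟙 ∘ isEdge) pairs ⟩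
    (∑[ p ∈ pairs ] 𝟙 (isEdge p)) * ((q ∸ 2) C s)
      ≡⟨ cong (_* ((q ∸ 2) C s)) e≡∑isEdge ⟨
    e F * ((q ∸ 2) C s) ∎
    where
    open ≤-Reasoning
    t : ℕ
    t = 2 + s

lemma3p8 : (q t : ℕ) → 2 ≤ q → 2 ≤ t → (F : Graph q) →
    2 * (t * t) * e F < q * q →
    q C t ≤ 2 * numIndependent F t
lemma3p8 (suc (suc n)) (suc (suc s)) (s≤s (s≤s z≤n)) (s≤s (s≤s z≤n)) F sparse = begin
  (2 + n) C (2 + s)       ≡⟨ numIndependent+numDependent F (2 + s) ⟨
  independent + dependent ≤⟨ 2n≤m+n⇒m+n≤2m {independent} {dependent} (begin
    2 * dependent           ≤⟨ *-monoʳ-≤ 2 (numDependent≤e·C F s) ⟩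
    2 * (e F * (n C s))     ≡⟨ *-assoc 2 (e F) (n C s) ⟨
    2 * e F * (n C s)       ≤⟨ 2e·nCs≤[2+n]C[2+s] n s (e F) sparse ⟩
    (2 + n) C (2 + s)       ≡⟨ numIndependent+numDependent F (2 + s) ⟨
    independent + dependent ∎) ⟩
  2 * independent         ∎
  where
  open ≤-Reasoning
  independent dependent : ℕ
  independent = numIndependent F (2 + s)
  dependent   = numDependent F (2 + s)
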